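{- Let $m>3$ be an integer and $a,b,c$ positive integers. Then for each prime $q_i$ ($i=1,2,\dots$) in the sequence $(q_i)$ there exists an integer $N_i$ such that $\operatorname{ord}_{q_i}N_i=1$, $N_i\equiv (m-4)^2(a+b)\pmod{8(m-2)}$, $N_i\equiv 8(m-2)c+q_0\pmod{q_0^2}$, $\gcd(N_i/q_i,P_c)=1$, and $N_i=8(m-2)n_i+(m-4)^2(a+b)$ for a positive integer $n_i$ with $n_i\le K(a,b,c)q_0^2q_i$; moreover, if $\operatorname{ord}_2(m)\ge 2$, then $n_i\equiv\lfloor 2/\operatorname{ord}_2(m)\rfloor(a+b+c)\pmod 8$.
   Context: For an integer $D$, $\mathbb{P}(D)$ is the set of primes $q$ with $(D/q)=-1$ (Kronecker symbol). $P(\ell)$ is the set of prime factors of $\ell$. For positive integers $\ell_1,\ell_2$, $P_m(\ell_1,\ell_2)$ is the set of primes $q$ with $q\mid\ell_1$, $(-4\ell_2/q)=-1$ and $q\nmid m-2$. $P_c$ is the product of the primes in $P_m(c,ab)$; $P_{ab}$ is the product of the primes in $P_m(a,bc)\cup P_m(b,ac)$; $P_{abc}$ is the product of the primes in $P_m(a,bc)\cup P_m(b,ac)\cup P_m(c,ab)$ (empty products are $1$). $\rho(n):=2^{\omega(n)}n/\phi(n)$ with $\omega(n)$ the number of distinct prime divisors and $\phi$ Euler's totient; $K(a,b,c):=24P_{ab}\rho(P_{abc})$. $q_0$ is the smallest prime in $\mathbb{P}(-4ab)\setminus(P(m-2)\cup P_m(c,ab))$ (this set is nonempty), and $q_1<q_2<\cdots$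 is the increasing enumeration of all primes in $\mathbb{P}(-4ab)\setminus P(q_0(m-2))$. -}

module Defs where

open import Data.Nat using (ℕ; zero; suc; _+_; _*_; _∸_; _^_; _/_; _%_; _≡ᵇ_; _≤_)
open import Data.Nat.Divisibility using (_∣_; _∣?_)
open import Data.Nat.Primality using (prime?)
open import Data.Nat.GCD using (gcd)
open import Data.Integer as ℤ using (ℤ; +_; _%ℕ_)
import Data.Integer.Divisibility as ℤD
open import Data.Bool using (Bool; true; false; _∧_; _∨_; not; if_then_else_; T)
open import Data.List using (List; upTo; applyUpTo; filter; length; foldr)
open import Data.Bool.ListAction using (any)
open import Relation.Nullary.Decidable using (does)
open import Relation.Binary.PropositionalEquality using (_≡_)
open import Data.Product using (_×_)
open import Relation.Nullary using (¬_)

isPrime : ℕ → Bool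
isPrime q = does (prime? q)

_∣ᵇ_ : ℕ → ℕ → Bool
p ∣ᵇ n = does (p ∣? n)

-- truncated division (with m div 0 = 0 by convention; only used for nonzero divisors)
_div_ : ℕ → ℕ → ℕ
m div zero = 0
m div suc k = m / suc k

-- Kronecker symbol (D/q) for a prime q
-- q = 2 : 0 if D even, 1 if D ≡ ±1 (mod 8), -1 if D ≡ ±3 (mod 8)
-- q odd : Legendre symbol (0 if q ∣ D, 1 if D is a nonzero square mod q, -1 otherwise)
kronecker : ℤ → ℕ → ℤ
kronecker D zero = + 0
kronecker D (suc (suc zero)) =
  let r = D %ℕ 8 in
  if (r % 2) ≡ᵇ 0 then + 0
  else (if (r ≡ᵇ 1) ∨ (r ≡ᵇ 7) then + 1 else ℤ.- (+ 1))
kronecker D (suc k) =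
  let r = D %ℕ (suc k) in
  if r ≡ᵇ 0 then + 0
  else (if any (λ x → ((x * x) % suc k) ≡ᵇ r) (upTo (suc k)) then + 1 else ℤ.- (+ 1))

kronNeg : ℤ → ℕ → Bool
kronNeg D q = does (kronecker D q ℤ.≟ ℤ.- (+ 1))

inPD : ℤ → ℕ → Bool
inPD D q = isPrime q ∧ kronNeg D q

minus4 : ℕ → ℤ
minus4 l = ℤ.- (+ (4 * l))

inPm : ℕ → ℕ → ℕ → ℕ → Bool
inPm m l₁ l₂ q = isPrime q ∧ (q ∣ᵇ l₁) ∧ kronNeg (minus4 l₂) q ∧ not (q ∣ᵇ (m ∸ 2))

prodUpTo : ℕ → (ℕ → Bool) → ℕ
prodUpTo B f = foldr (λ q acc → (if f q then q else 1) * acc) 1 (upTo (suc B))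

-- P_c, P_ab, P_abc  (all primes in the relevant sets divide a, b or c, hence are ≤ the bound)
Pc : ℕ → ℕ → ℕ → ℕ → ℕ
Pc m a b c = prodUpTo c (inPm m c (a * b))

Pab : ℕ → ℕ → ℕ → ℕ → ℕ
Pab m a b c = prodUpTo (a + b) (λ q → inPm m a (b * c) q ∨ inPm m b (a * c) q)

Pabc : ℕ → ℕ → ℕ → ℕ → ℕ
Pabc m a b c = prodUpTo (a + b + c)
  (λ q → inPm m a (b * c) q ∨ inPm m b (a * c) q ∨ inPm m c (a * b) q)

φ : ℕ → ℕ
φ n = length (filter (λ k → gcd k n Data.Nat.≟ 1) (applyUpTo suc n))

ω : ℕ → ℕ
ω n = length (filter (λ p → prime? p Relation.Nullary.×-dec (p ∣? n)) (upTo (suc n)))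

-- q-adic valuation ord_p n (for p ≥ 2, n ≥ 1); fuel n suffices
ordF : ℕ → ℕ → ℕ → ℕ
ordF zero p n = 0
ordF (suc f) p zero = 0
ordF (suc f) p (suc n) = if p ∣ᵇ suc n then suc (ordF f p (suc n div p)) else 0

ord : ℕ → ℕ → ℕ
ord p n = ordF n p n

infix 4 _≅_[mod_]
_≅_[mod_] : ℕ → ℕ → ℕ → Set
x ≅ y [mod k ] = (+ k) ℤD.∣ ((+ x) ℤ.- (+ y))

inQ0Set : ℕ → ℕ → ℕ → ℕ → ℕ → Bool
inQ0Set m a b c q = inPD (minus4 (a * b)) q ∧ not (q ∣ᵇ (m ∸ 2)) ∧ not (inPm m c (a * b) q)

IsQ0 : ℕ → ℕ → ℕ → ℕ → ℕ → Set
IsQ0 m a b c q₀ = T (inQ0Set m a b c q₀) × (∀ q → T (inQ0Set m a b c q) → q₀ ≤ q)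

-- q is one of the primes q₁ < q₂ < ⋯ : q ∈ ℙ(-4ab) \ P(q₀(m-2))
InQSeq : ℕ → ℕ → ℕ → ℕ → ℕ → Set
InQSeq m a b q₀ q = T (inPD (minus4 (a * b)) q) × ¬ (q ∣ q₀ * (m ∸ 2))

module Submission where

-- Write n = s + 8q₀²(t₀ + q u) and N = 8(m-2)n + (m-4)²(a+b). The offset s ≤ 8q₀² fixes n mod 8 and
-- N mod q₀² (a linear congruence whose coefficient 64(m-2) is a unit mod q₀²), and t₀ < q makes
-- q ∣ N. Then N / q = K + β u is linear in u, so each prime p of {q} ∪ P_c excludes exactly one
-- residue class of u. Sieving out these k classes by inclusion-exclusion, with a counting error of at
-- most 2^k - 1, leaves an admissible u below 2^k ∏ p / ∏ (p - 1). As the primes of P_c other than q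
-- divide P_abc, their ∏ p / ∏ (p - 1) is at most P_abc / φ(P_abc), and q / (q - 1) ≤ 3 / 2 accounts
-- for q.

open import Defs
open import Data.Bool using (Bool; true; false; not; _∧_; _∨_; if_then_else_; T)
open import Data.Bool.Properties using (T-∧; T-∨)
open import Data.Empty using (⊥; ⊥-elim)
open import Data.List using (List; []; _∷_; _∷ʳ_; foldr; length; filter; applyUpTo; upTo)
open import Data.List.Properties using (foldr-∷ʳ; upTo-∷ʳ)
open import Data.List.Relation.Unary.All as All using (All; []; _∷_)
open import Data.Nat
open import Data.Nat.Properties
open import Data.Nat.Divisibility
open import Data.Nat.DivMod hiding (_div_)
open import Data.Nat.Primality
open import Data.Nat.Primality.Factorisation using (factorise)
open import Data.Nat.GCD using (gcd; module Bézout)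
open import Data.Nat.Coprimality using (Coprime; coprime-Bézout; coprime⇒gcd≡1; gcd≡1⇒coprime)
open import Data.Nat.Tactic.RingSolver using (solve-∀)
open import Data.Integer as ℤ using (ℤ)
import Data.Integer.Properties as ℤ
import Data.Integer.Divisibility.Signed as ℤ
import Data.Integer.DivMod as ℤ
import Data.Integer.Tactic.RingSolver as ℤRing
open import Data.Product using (∃; ∃-syntax; _×_; _,_; proj₁; proj₂)
open import Data.Sum using (inj₁; inj₂; [_,_])
open import Function using (Equivalence; _∘_; id)
open import Relation.Nullary using (¬_; Dec; yes; no; _×-dec_)
open import Relation.Nullary.Decidable using (does)
open import Relation.Unary using (Decidable)
open import Relation.Binary.PropositionalEquality hiding ([_])

T-does⇒ : ∀ {A : Set} (a? : Dec A) → T (does a?) → A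
T-does⇒ (yes a) _ = a

⇒T-does : ∀ {A : Set} (a? : Dec A) → A → T (does a?)
⇒T-does (yes _) _ = _
⇒T-does (no ¬a) a = ¬a a

T-not-does⇒¬ : ∀ {A : Set} (a? : Dec A) → T (not (does a?)) → ¬ A
T-not-does⇒¬ (no ¬a) _ = ¬a

¬⇒T-not-does : ∀ {A : Set} (a? : Dec A) → ¬ A → T (not (does a?))
¬⇒T-not-does (yes a) ¬a = ¬a a
¬⇒T-not-does (no _) _ = _

T-ext : ∀ {x y : Bool} → (T x → T y) → (T y → T x) → x ≡ y
T-ext {false} {false} _ _ = refl
T-ext {false} {true} _ y⇒x = ⊥-elim (y⇒x _)
T-ext {true} {false} x⇒y _ = ⊥-elim (x⇒y _)
T-ext {true} {true} _ _ = refl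

T-not⇒¬T : ∀ {b} → T (not b) → ¬ T b
T-not⇒¬T {false} _ ()

bump : Bool → ℕ → ℕ
bump b n = if b then suc n else n

bump-comm : ∀ b c n → bump b (bump c n) ≡ bump c (bump b n)
bump-comm false c n = refl
bump-comm true false n = refl
bump-comm true true n = refl

bump-mono : ∀ {b c m n} → (T b → T c) → m ≤ n → bump b m ≤ bump c n
bump-mono {false} {false} _ m≤n = m≤n
bump-mono {false} {true} _ m≤n = m≤n⇒m≤1+n m≤n
bump-mono {true} {false} b⇒c _ = ⊥-elim (b⇒c _)
bump-mono {true} {true} _ m≤n = s≤s m≤n

n≤bump : ∀ b n → n ≤ bump b n
n≤bump false n = ≤-refl
n≤bump true n = n≤1+n n

count : (ℕ → Bool) → ℕ → ℕ
count f zero = 0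
count f (suc X) = bump (f X) (count f X)

count-cong : ∀ {f g} → (∀ u → f u ≡ g u) → ∀ X → count f X ≡ count g X
count-cong f≗g zero = refl
count-cong f≗g (suc X) = cong₂ bump (f≗g X) (count-cong f≗g X)

count-true : ∀ X → count (λ _ → true) X ≡ X
count-true zero = refl
count-true (suc X) = cong suc (count-true X)

count-partition : ∀ (b g : ℕ → Bool) X →
  count (λ u → not (b u) ∧ g u) X + count (λ u → b u ∧ g u) X ≡ count g X
count-partition b g zero = refl
count-partition b g (suc X) with b X | g X | count-partition b g X
... | false | false | eq = eq
... | false | true  | eq = cong suc eq
... | true  | false | eq = eq
... | true  | true  | eq = trans (+-suc _ _) (cong suc eq)

count-mono : ∀ {f g} X → (∀ u → u < X → T (f u) → T (g u)) → count f X ≤ count g X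
count-mono zero _ = z≤n
count-mono (suc X) f⇒g =
  bump-mono (f⇒g X ≤-refl) (count-mono X (λ u u<X → f⇒g u (m≤n⇒m≤1+n u<X)))

count-monoʳ : ∀ g {X Y} → X ≤ Y → count g X ≤ count g Y
count-monoʳ g {Y = zero} z≤n = z≤n
count-monoʳ g {X} {suc Y} X≤1+Y with m≤n⇒m<n∨m≡n X≤1+Y
... | inj₂ refl = ≤-refl
... | inj₁ X<1+Y = ≤-trans (count-monoʳ g (s≤s⁻¹ X<1+Y)) (n≤bump (g Y) (count g Y))

count-front : ∀ f X → count f (suc X) ≡ bump (f 0) (count (f ∘ suc) X)
count-front f zero = refl
count-front f (suc X) =
  trans (cong (bump (f (suc X))) (count-front f X)) (bump-comm (f (suc X)) (f 0) _)

length-filter-∷ : ∀ {P : ℕ → Set} (P? : Decidable P) x xs →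
  length (filter P? (x ∷ xs)) ≡ bump (does (P? x)) (length (filter P? xs))
length-filter-∷ P? x xs with does (P? x)
... | true = refl
... | false = refl

length-filter-applyUpTo : ∀ {P : ℕ → Set} (P? : Decidable P) g n →
  length (filter P? (applyUpTo g n)) ≡ count (λ u → does (P? (g u))) n
length-filter-applyUpTo P? g zero = refl
length-filter-applyUpTo P? g (suc n) = begin
  length (filter P? (applyUpTo g (suc n)))                         ≡⟨ length-filter-∷ P? (g 0) _ ⟩
  bump (does (P? (g 0))) (length (filter P? (applyUpTo (g ∘ suc) n))) ≡⟨ cong (bump _) (length-filter-applyUpTo P? (g ∘ suc) n) ⟩
  bump (does (P? (g 0))) (count (λ u → does (P? (g (suc u)))) n)     ≡⟨ count-front _ n ⟨
  count (λ u → does (P? (g u))) (suc n)                              ∎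
  where open ≡-Reasoning

count-witness : ∀ f X → 0 < count f X → ∃ λ u → u < X × T (f u)
count-witness f (suc X) pos with f X in eq
... | true = X , ≤-refl , subst T (sym eq) _
... | false with count-witness f X pos
...   | u , u<X , fu = u , m≤n⇒m≤1+n u<X , fu

count-transfer : ∀ {f g} X Y → (∀ u → u < X → T (f u) → T (g u) × u < Y) →
  count f X ≤ count g Y
count-transfer {f} {g} X Y h = ≤-trans (below-min X h) (count-monoʳ g (m⊓n≤n X Y))
  where
  below-min : ∀ X → (∀ u → u < X → T (f u) → T (g u) × u < Y) → count f X ≤ count g (X ⊓ Y)
  below-min zero _ = z≤n
  below-min (suc X) h with f X in eq
  ... | false = ≤-trans (below-min X (λ u u<X → h u (m≤n⇒m≤1+n u<X)))
                        (count-monoʳ g (⊓-monoˡ-≤ Y (n≤1+n X)))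
  ... | true with h X ≤-refl (subst T (sym eq) _)
  ...   | gX , X<Y = ≤-trans
          (bump-mono {true} (λ _ → gX)
            (≤-trans (below-min X (λ u u<X → h u (m≤n⇒m≤1+n u<X))) (count-monoʳ g (m⊓n≤m X Y))))
          (≤-reflexive (cong (count g) (sym (m≤n⇒m⊓n≡m X<Y))))

module ResidueClass (p : ℕ) .{{_ : NonZero p}} (j₀ : ℕ) (j₀<p : j₀ < p) where

  inClass : ℕ → Bool
  inClass u = u % p ≡ᵇ j₀

  inClass-progression : ∀ k → (j₀ + k * p) % p ≡ j₀
  inClass-progression k = trans ([m+kn]%n≡m%n j₀ k p) (m<n⇒m%n≡m j₀<p)

  no-overshoot : ∀ {X k d} → j₀ + k * p ≡ X + d → d < p → X % p ≡ j₀ → d ≡ 0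
  no-overshoot {X} {k} {d} eq d<p X%p = begin
    d                     ≡⟨ sym (m<n⇒m%n≡m d<p) ⟩
    d % p                 ≡⟨ sym ([m+kn]%n≡m%n d (X / p) p) ⟩
    (d + X / p * p) % p   ≡⟨ cong (_% p) (+-cancelˡ-≡ j₀ _ _ j₀+d+X/p*p≡j₀+k*p) ⟩
    k * p % p             ≡⟨ m*n%n≡0 k p ⟩
    0                     ∎
    where
    open ≡-Reasoning
    j₀+d+X/p*p≡j₀+k*p : j₀ + (d + X / p * p) ≡ j₀ + k * p
    j₀+d+X/p*p≡j₀+k*p = begin
      j₀ + (d + X / p * p)   ≡⟨ cong (j₀ +_) (+-comm d _) ⟩
      j₀ + (X / p * p + d)   ≡⟨ sym (+-assoc j₀ _ d) ⟩
      j₀ + X / p * p + d     ≡⟨ cong (λ z → z + X / p * p + d) (sym X%p) ⟩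
      X % p + X / p * p + d  ≡⟨ cong (_+ d) (sym (m≡m%n+[m/n]*n X p)) ⟩
      X + d                  ≡⟨ sym eq ⟩
      j₀ + k * p             ∎

  -- The least member of the class that is ≥ X is j₀ + count inClass X * p.
  class-size : ∀ X → ∃ λ d → d < p × j₀ + count inClass X * p ≡ X + d
  class-size zero = j₀ , j₀<p , +-identityʳ j₀
  class-size (suc X) with class-size X | inClass X in eq
  ... | d , d<p , eqX | true = pred p , ≤-reflexive (suc-pred p) , (begin
        j₀ + suc (count inClass X) * p   ≡⟨ cong (j₀ +_) (+-comm p _) ⟩
        j₀ + (count inClass X * p + p)   ≡⟨ sym (+-assoc j₀ _ p) ⟩
        j₀ + count inClass X * p + p     ≡⟨ cong (_+ p) (trans eqX (cong (X +_) d≡0)) ⟩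
        X + 0 + p                        ≡⟨ cong (_+ p) (+-identityʳ X) ⟩
        X + p                            ≡⟨ cong (X +_) (sym (suc-pred p)) ⟩
        X + suc (pred p)                 ≡⟨ +-suc X (pred p) ⟩
        suc X + pred p                   ∎)
    where
    open ≡-Reasoning
    d≡0 : d ≡ 0
    d≡0 = no-overshoot {k = count inClass X} eqX d<p (≡ᵇ⇒≡ _ _ (subst T (sym eq) _))
  ... | zero , _ , eqX | false =
    ⊥-elim (subst T eq (≡⇒≡ᵇ _ _ (trans (cong (_% p) (sym (trans eqX (+-identityʳ X))))
                                        (inClass-progression (count inClass X)))))
  ... | suc d , d<p , eqX | false = d , <-trans (n<1+n d) d<p , trans eqX (+-suc X d)

  class-member : ∀ X → T (inClass X) → X ≡ j₀ + count inClass X * p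
  class-member X t with class-size X
  ... | d , d<p , eqX = sym (trans eqX (trans (cong (X +_) d≡0) (+-identityʳ X)))
    where d≡0 = no-overshoot {k = count inClass X} eqX d<p (≡ᵇ⇒≡ _ _ t)

  count-class : ∀ h X →
    count (λ u → inClass u ∧ h u) X ≡ count (λ k → h (j₀ + k * p)) (count inClass X)
  count-class h zero = refl
  count-class h (suc X) with inClass X in eq
  ... | true = cong₂ bump (cong h (class-member X (subst T (sym eq) _))) (count-class h X)
  ... | false = count-class h X

prime⇒≢1 : ∀ {p} → Prime p → p ≢ 1
prime⇒≢1 pp = nonTrivial⇒≢1 {{prime⇒nonTrivial pp}}

prime∤⇒coprime : ∀ {p n} → Prime p → ¬ p ∣ n → Coprime n p
prime∤⇒coprime pp p∤n (d∣n , d∣p) with prime⇒irreducible pp d∣p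
... | inj₁ d≡1 = d≡1
... | inj₂ refl = ⊥-elim (p∤n d∣n)

prime∤-* : ∀ {p m n} → Prime p → ¬ p ∣ m → ¬ p ∣ n → ¬ p ∣ m * n
prime∤-* {m = m} {n} pp p∤m p∤n p∣mn = [ p∤m , p∤n ] (euclidsLemma m n pp p∣mn)

prime⇒suc : ∀ {p} → Prime p → ∃ λ p₁ → p ≡ suc p₁
prime⇒suc {zero} pp = ⊥-elim (NonZero.nonZero (prime⇒nonZero pp))
prime⇒suc {suc p₁} _ = p₁ , refl

prime∣prime⇒≡ : ∀ {p q} → Prime p → Prime q → q ∣ p → q ≡ p
prime∣prime⇒≡ pp pq q∣p with prime⇒irreducible pp q∣p
... | inj₁ q≡1 = ⊥-elim (prime⇒≢1 pq q≡1)
... | inj₂ q≡p = q≡p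

prime∤-^ : ∀ {p x} → Prime p → ¬ p ∣ x → ∀ n → ¬ p ∣ x ^ n
prime∤-^ pp p∤x zero p∣1 = prime⇒≢1 pp (∣1⇒≡1 p∣1)
prime∤-^ pp p∤x (suc n) = prime∤-* pp p∤x (prime∤-^ pp p∤x n)

odd-prime∤2^ : ∀ {p} → Prime p → p ≢ 2 → ∀ n → ¬ p ∣ 2 ^ n
odd-prime∤2^ pp p≢2 = prime∤-^ pp (λ p∣2 → p≢2 (prime∣prime⇒≡ prime[2] pp p∣2))

prime-factor : ∀ n → 2 ≤ n → ∃ λ r → Prime r × r ∣ n
prime-factor (suc zero) (s≤s ())
prime-factor (suc (suc n)) _ with factorise (suc (suc n))
... | record { factors = [] ; isFactorisation = () }
... | record { factors = r ∷ _ ; isFactorisation = eq ; factorsPrime = pr ∷ _ } =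
  r , pr , subst (r ∣_) (sym eq) (m∣m*n _)

linear-split : ∀ α β p u .{{_ : NonZero p}} → α + β * u ≡ β * (u / p) * p + (α + β * (u % p))
linear-split α β p u = begin
  α + β * u                             ≡⟨ cong (λ z → α + β * z) (m≡m%n+[m/n]*n u p) ⟩
  α + β * (u % p + u / p * p)           ≡⟨ shuffle α β (u % p) (u / p) p ⟩
  β * (u / p) * p + (α + β * (u % p))   ∎
  where
  open ≡-Reasoning
  shuffle : ∀ α β r k p → α + β * (r + k * p) ≡ β * k * p + (α + β * r)
  shuffle = solve-∀

∣-linear⇔∣-linear-mod : ∀ {p} α β u .{{_ : NonZero p}} →
  (p ∣ α + β * u → p ∣ α + β * (u % p)) × (p ∣ α + β * (u % p) → p ∣ α + β * u)
∣-linear⇔∣-linear-mod {p} α β u =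
  (λ d → ∣m+n∣m⇒∣n (subst (p ∣_) split d) multiple) ,
  (λ d → subst (p ∣_) (sym split) (∣m∣n⇒∣m+n multiple d))
  where
  split = linear-split α β p u
  multiple = n∣m*n (β * (u / p))

-- Bézout gives x with x β ≡ ±1 (mod p); multiplying by α (and by p - 1 in the + case) makes α + β j ≡ 0.
solve-linear : ∀ {p} α β .{{_ : NonZero p}} → Coprime β p → ∃ λ j → j < p × p ∣ α + β * j
solve-linear {p} α β cop = reduce (root (coprime-Bézout cop))
  where
  reduce : ∃ (λ j → p ∣ α + β * j) → ∃ λ j → j < p × p ∣ α + β * j
  reduce (j , d) = j % p , m%n<n j p , proj₁ (∣-linear⇔∣-linear-mod α β j) d
  root : Bézout.Identity 1 β p → ∃ λ j → p ∣ α + β * j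
  root (Bézout.-+ x y eq) = α * x , divides (α * y) (begin
    α + β * (α * x)    ≡⟨ expand α β x ⟩
    α * (1 + x * β)    ≡⟨ cong (α *_) eq ⟩
    α * (y * p)        ≡⟨ sym (*-assoc α y p) ⟩
    α * y * p          ∎)
    where
    open ≡-Reasoning
    expand : ∀ α β x → α + β * (α * x) ≡ α * (1 + x * β)
    expand = solve-∀
  root (Bézout.+- x y eq) = α * x * pred p , divides (α + α * y * pred p) (begin
    α + β * (α * x * pred p)           ≡⟨ cong (α +_) (expand β α x (pred p)) ⟩
    α + x * β * α * pred p             ≡⟨ cong (λ z → α + z * α * pred p) (sym eq) ⟩
    α + (1 + y * p) * α * pred p       ≡⟨ cong (λ z → α + (1 + y * z) * α * pred p) (sym (suc-pred p)) ⟩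
    α + (1 + y * suc (pred p)) * α * pred p ≡⟨ collect α y (pred p) ⟩
    (α + α * y * pred p) * suc (pred p)     ≡⟨ cong ((α + α * y * pred p) *_) (suc-pred p) ⟩
    (α + α * y * pred p) * p           ∎)
    where
    open ≡-Reasoning
    expand : ∀ β α x q → β * (α * x * q) ≡ x * β * α * q
    expand = solve-∀
    collect : ∀ α y q → α + (1 + y * suc q) * α * q ≡ (α + α * y * q) * suc q
    collect = solve-∀

∣∧<⇒≡0 : ∀ {p x} → p ∣ x → x < p → x ≡ 0
∣∧<⇒≡0 {x = zero} _ _ = refl
∣∧<⇒≡0 {x = suc x} p∣x x<p = ⊥-elim (<⇒≱ x<p (∣⇒≤ p∣x))

root-unique-≤ : ∀ {p α β r j} → Prime p → ¬ p ∣ β →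
  p ∣ α + β * r → p ∣ α + β * j → r ≤ j → j < p → r ≡ j
root-unique-≤ {p} {α} {β} {r} {j} pp p∤β p∣r p∣j r≤j j<p =
  ≤-antisym r≤j (m∸n≡0⇒m≤n (∣∧<⇒≡0 p∣j∸r (≤-<-trans (m∸n≤m j r) j<p)))
  where
  split : α + β * j ≡ α + β * r + β * (j ∸ r)
  split = trans (cong (λ z → α + β * z) (sym (m+[n∸m]≡n r≤j))) (distrib α β r (j ∸ r))
    where
    distrib : ∀ α β r x → α + β * (r + x) ≡ α + β * r + β * x
    distrib = solve-∀
  p∣j∸r : p ∣ j ∸ r
  p∣j∸r = [ ⊥-elim ∘ p∤β , id ]
            (euclidsLemma β (j ∸ r) pp (∣m+n∣m⇒∣n (subst (p ∣_) split p∣j) p∣r))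

root-unique : ∀ {p α β r j} → Prime p → ¬ p ∣ β →
  p ∣ α + β * r → p ∣ α + β * j → r < p → j < p → r ≡ j
root-unique pp p∤β p∣r p∣j r<p j<p with ≤-total _ _
... | inj₁ r≤j = root-unique-≤ pp p∤β p∣r p∣j r≤j j<p
... | inj₂ j≤r = sym (root-unique-≤ pp p∤β p∣j p∣r j≤r r<p)

∣-linear⇔≡root-mod : ∀ {p α β j₀} .{{_ : NonZero p}} → Prime p → ¬ p ∣ β → j₀ < p → p ∣ α + β * j₀ →
  ∀ u → (p ∣ α + β * u → u % p ≡ j₀) × (u % p ≡ j₀ → p ∣ α + β * u)
∣-linear⇔≡root-mod {p} {α} {β} pp p∤β j₀<p p∣j₀ u =
  (λ d → root-unique pp p∤β (proj₁ (∣-linear⇔∣-linear-mod α β u) d) p∣j₀ (m%n<n u p) j₀<p) ,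
  (λ u%p≡j₀ → proj₂ (∣-linear⇔∣-linear-mod α β u) (subst (λ z → p ∣ α + β * z) (sym u%p≡j₀) p∣j₀))

-- Sieving one residue class per prime

-- avoid p α β is the condition p ∤ α + β x on x.
record Constraint : Set where
  constructor avoid
  field
    divisor offset slope : ℕ

open Constraint using (divisor)

satisfies : List Constraint → ℕ → Bool
satisfies [] x = true
satisfies (avoid p α β ∷ cs) x = not (p ∣ᵇ (α + β * x)) ∧ satisfies cs x

modulus : List Constraint → ℕ
modulus [] = 1
modulus (avoid p _ _ ∷ cs) = p * modulus cs

totient : List Constraint → ℕ
totient [] = 1
totient (avoid p _ _ ∷ cs) = (p ∸ 1) * totient cs

sieveError : List Constraint → ℕ
sieveError [] = 0
sieveError (_ ∷ cs) = 2 * sieveError cs + 1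

data Admissible : List Constraint → Set where
  [] : Admissible []
  _∷_ : ∀ {p α β cs} → Prime p × ¬ p ∣ β × All (λ c → divisor c ≢ p) cs →
        Admissible cs → Admissible (avoid p α β ∷ cs)

CoprimeTo : ℕ → List Constraint → Set
CoprimeTo s cs = All (λ c → ¬ divisor c ∣ s) cs

sieveCount : List Constraint → ℕ → ℕ → ℕ → ℕ
sieveCount cs a s X = count (λ u → satisfies cs (a + s * u)) X

totient≤modulus : ∀ cs → totient cs ≤ modulus cs
totient≤modulus [] = ≤-refl
totient≤modulus (avoid p _ _ ∷ cs) = *-mono-≤ (m∸n≤m p 1) (totient≤modulus cs)

sieveError+1 : ∀ cs → sieveError cs + 1 ≡ 2 ^ length cs
sieveError+1 [] = refl
sieveError+1 (_ ∷ cs) = trans (double (sieveError cs)) (cong (2 *_) (sieveError+1 cs))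
  where
  double : ∀ e → 2 * e + 1 + 1 ≡ 2 * (e + 1)
  double = solve-∀

totient-pos : ∀ {cs} → Admissible cs → 0 < totient cs
totient-pos [] = s≤s z≤n
totient-pos {avoid p _ _ ∷ _} ((pp , _) ∷ adm) =
  *-mono-< {0} {p ∸ 1} (∸-monoˡ-< (nonTrivial⇒n>1 p {{prime⇒nonTrivial pp}}) (s≤s z≤n)) (totient-pos adm)

-- The u ≡ j₀ (mod p) violating the first constraint are counted again in the progression k ↦ j₀ + k p.
record SieveStep (p α β : ℕ) (cs : List Constraint) (a s X : ℕ) : Set where
  field
    j₀ X′ d : ℕ
    j₀<p : j₀ < p
    d<p : d < p
    size : j₀ + X′ * p ≡ X + d
    partition : sieveCount (avoid p α β ∷ cs) a s X + sieveCount cs (a + s * j₀) (s * p) X′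
              ≡ sieveCount cs a s X

sieve-step : ∀ {p α β} cs → Prime p → ¬ p ∣ β → ∀ a s → ¬ p ∣ s → ∀ X → SieveStep p α β cs a s X
sieve-step {p} {α} {β} cs pp p∤β a s p∤s X = record
  { j₀ = j₀ ; X′ = count inClass X ; d = proj₁ (class-size X)
  ; j₀<p = j₀<p ; d<p = proj₁ (proj₂ (class-size X)) ; size = proj₂ (proj₂ (class-size X))
  ; partition = partition }
  where
  instance _ = prime⇒nonZero pp
  expand : ∀ u → α + β * (a + s * u) ≡ (α + β * a) + (β * s) * u
  expand u = shuffle α β a s u
    where
    shuffle : ∀ α β a s u → α + β * (a + s * u) ≡ (α + β * a) + (β * s) * u
    shuffle = solve-∀
  root = solve-linear (α + β * a) (β * s) (prime∤⇒coprime pp (prime∤-* pp p∤β p∤s))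
  j₀ = proj₁ root
  j₀<p = proj₁ (proj₂ root)
  open ResidueClass p j₀ j₀<p
  good : ℕ → Bool
  good u = satisfies cs (a + s * u)
  bad : ℕ → Bool
  bad u = p ∣ᵇ (α + β * (a + s * u))
  bad≡inClass : ∀ u → bad u ≡ inClass u
  bad≡inClass u = T-ext
    (λ t → ≡⇒≡ᵇ _ _ (proj₁ char (subst (p ∣_) (expand u) (T-does⇒ (p ∣? _) t))))
    (λ t → ⇒T-does (p ∣? _) (subst (p ∣_) (sym (expand u)) (proj₂ char (≡ᵇ⇒≡ _ _ t))))
    where
    char = ∣-linear⇔≡root-mod pp (prime∤-* pp p∤β p∤s) j₀<p (proj₂ (proj₂ root)) u
  reindex : ∀ k → a + s * (j₀ + k * p) ≡ (a + s * j₀) + (s * p) * k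
  reindex k = shuffle a s j₀ k p
    where
    shuffle : ∀ a s j k p → a + s * (j + k * p) ≡ (a + s * j) + (s * p) * k
    shuffle = solve-∀
  bad-count : count (λ u → bad u ∧ good u) X ≡ sieveCount cs (a + s * j₀) (s * p) (count inClass X)
  bad-count = begin
    count (λ u → bad u ∧ good u) X                     ≡⟨ count-cong (λ u → cong (_∧ good u) (bad≡inClass u)) X ⟩
    count (λ u → inClass u ∧ good u) X                 ≡⟨ count-class good X ⟩
    count (λ k → good (j₀ + k * p)) (count inClass X)  ≡⟨ count-cong (λ k → cong (satisfies cs) (reindex k)) (count inClass X) ⟩
    sieveCount cs (a + s * j₀) (s * p) (count inClass X) ∎
    where open ≡-Reasoning
  partition : sieveCount (avoid p α β ∷ cs) a s X + sieveCount cs (a + s * j₀) (s * p) (count inClass X)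
            ≡ sieveCount cs a s X
  partition = trans (cong (sieveCount (avoid p α β ∷ cs) a s X +_) (sym bad-count)) (count-partition bad good X)

admissible-primes : ∀ {cs} → Admissible cs → All (λ c → Prime (divisor c)) cs
admissible-primes [] = []
admissible-primes ((pp , _) ∷ adm) = pp ∷ admissible-primes adm

coprimeTo-* : ∀ {cs s p} → All (λ c → Prime (divisor c)) cs → All (λ c → divisor c ≢ p) cs →
  Prime p → CoprimeTo s cs → CoprimeTo (s * p) cs
coprimeTo-* [] [] _ [] = []
coprimeTo-* (pq ∷ pqs) (q≢p ∷ distinct) pp (q∤s ∷ cop) =
  prime∤-* pq q∤s (λ q∣p → q≢p (prime∣prime⇒≡ pp pq q∣p)) ∷ coprimeTo-* pqs distinct pp cop

-- G + B counts the progression against the remaining constraints, B the X′ ≈ X / p terms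
-- of it in the residue class removed by the first constraint.
sieve-lower-step : ∀ p₁ {X X′ G B Φ Q e} → let p = suc p₁ in
  X * Φ ≤ (G + B) * Q + e * Q → B * Q ≤ X′ * Φ + e * Q → X′ * p ≤ X + p → Φ ≤ Q →
  X * (p₁ * Φ) ≤ G * (p * Q) + (2 * e + 1) * (p * Q)
sieve-lower-step p₁ {X} {X′} {G} {B} {Φ} {Q} {e} lower upper X′p≤X+p Φ≤Q =
  +-cancelˡ-≤ (X * Φ) _ _ (begin
    X * Φ + X * (p₁ * Φ)                                  ≡⟨ expand₁ X Φ p₁ ⟩
    p * (X * Φ)                                           ≤⟨ *-monoʳ-≤ p lower ⟩
    p * ((G + B) * Q + e * Q)                             ≡⟨ expand₂ p G B Q e ⟩
    p * (B * Q) + (G * (p * Q) + p * (e * Q))             ≤⟨ +-monoˡ-≤ _ (*-monoʳ-≤ p upper) ⟩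
    p * (X′ * Φ + e * Q) + (G * (p * Q) + p * (e * Q))    ≡⟨ expand₃ p X′ Φ e Q G ⟩
    X′ * p * Φ + (G * (p * Q) + 2 * (p * (e * Q)))        ≤⟨ +-monoˡ-≤ _ (*-monoˡ-≤ Φ X′p≤X+p) ⟩
    (X + p) * Φ + (G * (p * Q) + 2 * (p * (e * Q)))       ≡⟨ expand₄ X p Φ _ ⟩
    X * Φ + (p * Φ + (G * (p * Q) + 2 * (p * (e * Q))))   ≤⟨ +-monoʳ-≤ (X * Φ) (+-monoˡ-≤ _ (*-monoʳ-≤ p Φ≤Q)) ⟩
    X * Φ + (p * Q + (G * (p * Q) + 2 * (p * (e * Q))))   ≡⟨ cong (X * Φ +_) (expand₅ p Q G e) ⟩
    X * Φ + (G * (p * Q) + (2 * e + 1) * (p * Q))         ∎)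
  where
  open ≤-Reasoning
  p = suc p₁
  expand₁ : ∀ X Φ p₁ → X * Φ + X * (p₁ * Φ) ≡ suc p₁ * (X * Φ)
  expand₁ = solve-∀
  expand₂ : ∀ p G B Q e → p * ((G + B) * Q + e * Q) ≡ p * (B * Q) + (G * (p * Q) + p * (e * Q))
  expand₂ = solve-∀
  expand₃ : ∀ p X Φ e Q G → p * (X * Φ + e * Q) + (G * (p * Q) + p * (e * Q))
                          ≡ X * p * Φ + (G * (p * Q) + 2 * (p * (e * Q)))
  expand₃ = solve-∀
  expand₄ : ∀ X p Φ r → (X + p) * Φ + r ≡ X * Φ + (p * Φ + r)
  expand₄ = solve-∀
  expand₅ : ∀ p Q G e → p * Q + (G * (p * Q) + 2 * (p * (e * Q))) ≡ G * (p * Q) + (2 * e + 1) * (p * Q)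
  expand₅ = solve-∀

sieve-upper-step : ∀ p₁ {X X′ G B Φ Q e} → let p = suc p₁ in
  (G + B) * Q ≤ X * Φ + e * Q → X′ * Φ ≤ B * Q + e * Q → X ≤ p + X′ * p → Φ ≤ Q →
  G * (p * Q) ≤ X * (p₁ * Φ) + (2 * e + 1) * (p * Q)
sieve-upper-step p₁ {X} {X′} {G} {B} {Φ} {Q} {e} upper lower X≤p+X′p Φ≤Q =
  +-cancelˡ-≤ (p * (B * Q)) _ _ (begin
    p * (B * Q) + G * (p * Q)                                    ≡⟨ expand₁ p B Q G ⟩
    p * ((G + B) * Q)                                            ≤⟨ *-monoʳ-≤ p upper ⟩
    p * (X * Φ + e * Q)                                          ≡⟨ expand₂ X Φ e Q p₁ ⟩
    X * Φ + (X * (p₁ * Φ) + p * (e * Q))                         ≤⟨ +-monoˡ-≤ _ XΦ≤ ⟩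
    (p * Q + p * (B * Q + e * Q)) + (X * (p₁ * Φ) + p * (e * Q)) ≡⟨ expand₃ p Q B e X p₁ Φ ⟩
    p * (B * Q) + (X * (p₁ * Φ) + (2 * e + 1) * (p * Q))         ∎)
  where
  open ≤-Reasoning
  p = suc p₁
  XΦ≤ : X * Φ ≤ p * Q + p * (B * Q + e * Q)
  XΦ≤ = begin
    X * Φ                      ≤⟨ *-monoˡ-≤ Φ X≤p+X′p ⟩
    (p + X′ * p) * Φ           ≡⟨ expand₄ p X′ Φ ⟩
    p * Φ + p * (X′ * Φ)       ≤⟨ +-mono-≤ (*-monoʳ-≤ p Φ≤Q) (*-monoʳ-≤ p lower) ⟩
    p * Q + p * (B * Q + e * Q) ∎
    where
    expand₄ : ∀ p X Φ → (p + X * p) * Φ ≡ p * Φ + p * (X * Φ)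
    expand₄ = solve-∀
  expand₁ : ∀ p B Q G → p * (B * Q) + G * (p * Q) ≡ p * ((G + B) * Q)
  expand₁ = solve-∀
  expand₂ : ∀ X Φ e Q p₁ → suc p₁ * (X * Φ + e * Q) ≡ X * Φ + (X * (p₁ * Φ) + suc p₁ * (e * Q))
  expand₂ = solve-∀
  expand₃ : ∀ p Q B e X p₁ Φ → (p * Q + p * (B * Q + e * Q)) + (X * (p₁ * Φ) + p * (e * Q))
                             ≡ p * (B * Q) + (X * (p₁ * Φ) + (2 * e + 1) * (p * Q))
  expand₃ = solve-∀

sieve-exact-step : ∀ p₁ {Y G B Φ Q} → let p = suc p₁ in
  (G + B) * Q ≡ Y * p * Q * Φ → B * Q ≡ Y * Q * Φ →
  G * (p * Q) ≡ Y * (p * Q) * (p₁ * Φ)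
sieve-exact-step p₁ {Y} {G} {B} {Φ} {Q} whole part = +-cancelˡ-≡ (p * (B * Q)) _ _ (begin
  p * (B * Q) + G * (p * Q)                   ≡⟨ expand₁ p B Q G ⟩
  p * ((G + B) * Q)                           ≡⟨ cong (p *_) whole ⟩
  p * (Y * p * Q * Φ)                         ≡⟨ expand₂ p₁ Y Q Φ ⟩
  p * (Y * Q * Φ) + Y * (p * Q) * (p₁ * Φ)    ≡⟨ cong (λ z → p * z + Y * (p * Q) * (p₁ * Φ)) (sym part) ⟩
  p * (B * Q) + Y * (p * Q) * (p₁ * Φ)        ∎)
  where
  open ≡-Reasoning
  p = suc p₁
  expand₁ : ∀ p B Q G → p * (B * Q) + G * (p * Q) ≡ p * ((G + B) * Q)
  expand₁ = solve-∀
  expand₂ : ∀ p₁ Y Q Φ → suc p₁ * (Y * suc p₁ * Q * Φ) ≡ suc p₁ * (Y * Q * Φ) + Y * (suc p₁ * Q) * (p₁ * Φ)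
  expand₂ = solve-∀

[j+kp]/p≡k : ∀ {p} .{{_ : NonZero p}} j k → j < p → (j + k * p) / p ≡ k
[j+kp]/p≡k {p} j k j<p = begin
  (j + k * p) / p       ≡⟨ +-distrib-/-∣ʳ j (n∣m*n k) ⟩
  j / p + k * p / p     ≡⟨ cong₂ _+_ (m<n⇒m/n≡0 j<p) (m*n/n≡m k p) ⟩
  k                     ∎
  where open ≡-Reasoning

SieveBounds : List Constraint → ℕ → ℕ → ℕ → Set
SieveBounds cs a s X =
  X * totient cs ≤ sieveCount cs a s X * modulus cs + sieveError cs * modulus cs ×
  sieveCount cs a s X * modulus cs ≤ X * totient cs + sieveError cs * modulus cs

sieve-bounds : ∀ {cs} → Admissible cs → ∀ a s → CoprimeTo s cs → ∀ X → SieveBounds cs a s X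
sieve-bounds [] a s [] X rewrite count-true X = m≤m+n (X * 1) 0 , m≤m+n (X * 1) 0
sieve-bounds {avoid p α β ∷ cs} ((pp , p∤β , distinct) ∷ adm) a s (p∤s ∷ cop) X
  with prime⇒suc pp
... | p₁ , refl =
  sieve-lower-step p₁ {X} {X′} {G} {B} {Φ} {Q} {e} (subst (λ z → X * Φ ≤ z * Q + e * Q) (sym partition) (proj₁ ih))
    (proj₂ ih′) X′p≤X+p Φ≤Q ,
  sieve-upper-step p₁ {X} {X′} {G} {B} {Φ} {Q} {e} (subst (λ z → z * Q ≤ X * Φ + e * Q) (sym partition) (proj₂ ih))
    (proj₁ ih′) X≤p+X′p Φ≤Q
  where
  open SieveStep (sieve-step {α = α} cs pp p∤β a s p∤s X)
  G = sieveCount (avoid (suc p₁) α β ∷ cs) a s X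
  B = sieveCount cs (a + s * j₀) (s * suc p₁) X′
  Φ = totient cs
  Q = modulus cs
  e = sieveError cs
  Φ≤Q = totient≤modulus cs
  ih = sieve-bounds adm a s cop X
  ih′ = sieve-bounds adm (a + s * j₀) (s * suc p₁)
          (coprimeTo-* (admissible-primes adm) distinct pp cop) X′
  X′p≤X+p : X′ * suc p₁ ≤ X + suc p₁
  X′p≤X+p = ≤-trans (m≤n+m _ j₀) (≤-trans (≤-reflexive size) (+-monoʳ-≤ X (<⇒≤ d<p)))
  X≤p+X′p : X ≤ suc p₁ + X′ * suc p₁
  X≤p+X′p = ≤-trans (m≤m+n X d) (≤-trans (≤-reflexive (sym size)) (+-monoˡ-≤ _ (<⇒≤ j₀<p)))

sieve-exact : ∀ {cs} → Admissible cs → ∀ a s → CoprimeTo s cs → ∀ Y →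
  sieveCount cs a s (Y * modulus cs) * modulus cs ≡ Y * modulus cs * totient cs
sieve-exact [] a s [] Y rewrite count-true (Y * 1) = refl
sieve-exact {avoid p α β ∷ cs} ((pp , p∤β , distinct) ∷ adm) a s (p∤s ∷ cop) Y
  with prime⇒suc pp
... | p₁ , refl = sieve-exact-step p₁ {Y} {G} {B} whole part
  where
  P = suc p₁
  Q = modulus cs
  open SieveStep (sieve-step {α = α} cs pp p∤β a s p∤s (Y * (P * Q)))
  G = sieveCount (avoid P α β ∷ cs) a s (Y * (P * Q))
  B = sieveCount cs (a + s * j₀) (s * P) X′
  X′≡YQ : X′ ≡ Y * Q
  X′≡YQ = begin
    X′                        ≡⟨ sym ([j+kp]/p≡k j₀ X′ j₀<p) ⟩
    (j₀ + X′ * P) / P         ≡⟨ cong (_/ P) (trans size (trans (+-comm _ d) (cong (d +_) (reassoc Y P Q)))) ⟩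
    (d + Y * Q * P) / P       ≡⟨ [j+kp]/p≡k d (Y * Q) d<p ⟩
    Y * Q                     ∎
    where
    open ≡-Reasoning
    reassoc : ∀ Y P Q → Y * (P * Q) ≡ Y * Q * P
    reassoc = solve-∀
  whole : (G + B) * Q ≡ Y * P * Q * totient cs
  whole = begin
    (G + B) * Q                               ≡⟨ cong (_* Q) partition ⟩
    sieveCount cs a s (Y * (P * Q)) * Q       ≡⟨ cong (λ z → sieveCount cs a s z * Q) (sym (*-assoc Y P Q)) ⟩
    sieveCount cs a s (Y * P * Q) * Q         ≡⟨ sieve-exact adm a s cop (Y * P) ⟩
    Y * P * Q * totient cs                    ∎
    where open ≡-Reasoning
  part : B * Q ≡ Y * Q * totient cs
  part = begin
    B * Q                                             ≡⟨ cong (λ z → sieveCount cs (a + s * j₀) (s * P) z * Q) X′≡YQ ⟩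
    sieveCount cs (a + s * j₀) (s * P) (Y * Q) * Q    ≡⟨ sieve-exact adm (a + s * j₀) (s * P) (coprimeTo-* (admissible-primes adm) distinct pp cop) Y ⟩
    Y * Q * totient cs                                ∎
    where open ≡-Reasoning

coprimeTo-1 : ∀ {cs} → All (λ c → Prime (divisor c)) cs → CoprimeTo 1 cs
coprimeTo-1 [] = []
coprimeTo-1 (pp ∷ pps) = (λ p∣1 → prime⇒≢1 pp (∣1⇒≡1 p∣1)) ∷ coprimeTo-1 pps

sieve-witness : ∀ {cs} → Admissible cs → ∀ X → 2 ^ length cs * modulus cs < X * totient cs + modulus cs →
  ∃ λ u → u < X × T (satisfies cs u)
sieve-witness {cs} adm X large with count-witness _ X count-pos
  where
  G = sieveCount cs 0 1 X
  Q = modulus cs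
  e = sieveError cs
  count-pos : 0 < G
  count-pos with G in eq
  ... | suc _ = s≤s z≤n
  ... | zero = ⊥-elim (<-irrefl refl (begin-strict
    2 ^ length cs * Q         <⟨ large ⟩
    X * totient cs + Q        ≤⟨ +-monoˡ-≤ Q (proj₁ (sieve-bounds adm 0 1 (coprimeTo-1 (admissible-primes adm)) X)) ⟩
    G * Q + e * Q + Q         ≡⟨ cong (λ z → z * Q + e * Q + Q) eq ⟩
    e * Q + Q                 ≡⟨ +-comm (e * Q) Q ⟩
    suc e * Q                 ≡⟨ cong (_* Q) (trans (+-comm 1 e) (sieveError+1 cs)) ⟩
    2 ^ length cs * Q         ∎))
    where open ≤-Reasoning
... | u , u<X , sat = u , u<X , subst (T ∘ satisfies cs) (+-identityʳ u) sat

factorIf : (ℕ → Bool) → ℕ → ℕ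
factorIf h x = if h x then x else 1

prodBelow : (ℕ → Bool) → ℕ → ℕ
prodBelow h zero = 1
prodBelow h (suc B) = prodBelow h B * factorIf h B

prodUpTo≡prodBelow : ∀ B h → prodUpTo B h ≡ prodBelow h (suc B)
prodUpTo≡prodBelow B h = product-upTo (suc B)
  where
  step : ℕ → ℕ → ℕ
  step x acc = factorIf h x * acc
  pull-init : ∀ xs k → foldr step k xs ≡ foldr step 1 xs * k
  pull-init [] k = sym (*-identityˡ k)
  pull-init (x ∷ xs) k =
    trans (cong (factorIf h x *_) (pull-init xs k)) (sym (*-assoc (factorIf h x) _ k))
  product-upTo : ∀ n → foldr step 1 (upTo n) ≡ prodBelow h n
  product-upTo zero = refl
  product-upTo (suc n) = begin
    foldr step 1 (upTo (suc n))                ≡⟨ cong (foldr step 1) (upTo-∷ʳ n) ⟨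
    foldr step 1 (upTo n ∷ʳ n)                 ≡⟨ foldr-∷ʳ step 1 n (upTo n) ⟩
    foldr step (factorIf h n * 1) (upTo n)     ≡⟨ pull-init (upTo n) _ ⟩
    foldr step 1 (upTo n) * (factorIf h n * 1) ≡⟨ cong₂ _*_ (product-upTo n) (*-identityʳ _) ⟩
    prodBelow h n * factorIf h n               ∎
    where open ≡-Reasoning

∣-prodBelow : ∀ {h x B} → x < B → T (h x) → x ∣ prodBelow h B
∣-prodBelow {h} {x} {suc B} x<1+B hx with m≤n⇒m<n∨m≡n x<1+B
... | inj₁ x<B = ∣m⇒∣m*n _ (∣-prodBelow (s≤s⁻¹ x<B) hx)
... | inj₂ refl with h x
...   | true = ∣n⇒∣m*n (prodBelow h x) ∣-refl

prodBelow-pos : ∀ {h} → (∀ x → T (h x) → 0 < x) → ∀ B → 0 < prodBelow h B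
prodBelow-pos h⇒pos zero = s≤s z≤n
prodBelow-pos {h} h⇒pos (suc B) with h B in eq
... | true = *-mono-< {0} {prodBelow h B} {0} (prodBelow-pos h⇒pos B) (h⇒pos B (subst T (sym eq) _))
... | false = subst (0 <_) (sym (*-identityʳ _)) (prodBelow-pos h⇒pos B)

prime∣prodBelow : ∀ {h r} → Prime r → (∀ x → T (h x) → Prime x) → ∀ B →
  r ∣ prodBelow h B → ∃ λ x → x < B × T (h x) × r ≡ x
prime∣prodBelow pr h⇒prime zero r∣1 = ⊥-elim (prime⇒≢1 pr (∣1⇒≡1 r∣1))
prime∣prodBelow {h} pr h⇒prime (suc B) r∣ with euclidsLemma (prodBelow h B) (factorIf h B) pr r∣
... | inj₁ r∣prod with prime∣prodBelow pr h⇒prime B r∣prod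
...   | x , x<B , hx , r≡x = x , m≤n⇒m≤1+n x<B , hx , r≡x
prime∣prodBelow {h} pr h⇒prime (suc B) r∣ | inj₂ r∣factor with h B in eq
... | true = B , ≤-refl , subst T (sym eq) _ , prime∣prime⇒≡ (h⇒prime B (subst T (sym eq) _)) pr r∣factor
... | false = ⊥-elim (prime⇒≢1 pr (∣1⇒≡1 r∣factor))

prodBelow-∣ : ∀ {h g} → (∀ x → T (h x) → T (g x)) → ∀ B → prodBelow h B ∣ prodBelow g B
prodBelow-∣ h⇒g zero = ∣-refl
prodBelow-∣ {h} {g} h⇒g (suc B) = *-pres-∣ (prodBelow-∣ h⇒g B) factor∣
  where
  factor∣ : factorIf h B ∣ factorIf g B
  factor∣ with h B in eh | g B in eg
  ... | false | _ = 1∣ _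
  ... | true | true = ∣-refl
  ... | true | false = ⊥-elim (subst T eg (h⇒g B (subst T (sym eh) _)))

prodBelow-monoʳ-∣ : ∀ h {B B′} → B ≤ B′ → prodBelow h B ∣ prodBelow h B′
prodBelow-monoʳ-∣ h {B′ = zero} z≤n = ∣-refl
prodBelow-monoʳ-∣ h {B} {suc B′} B≤1+B′ with m≤n⇒m<n∨m≡n B≤1+B′
... | inj₂ refl = ∣-refl
... | inj₁ B<1+B′ = ∣m⇒∣m*n _ (prodBelow-monoʳ-∣ h (s≤s⁻¹ B<1+B′))

constraintsBelow : (ℕ → Bool) → ℕ → ℕ → ℕ → List Constraint
constraintsBelow h α β zero = []
constraintsBelow h α β (suc B) =
  if h B then avoid B α β ∷ constraintsBelow h α β B else constraintsBelow h α β B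

module _ (h : ℕ → Bool) (α β : ℕ) where

  constraintsBelow-< : ∀ B → All (λ c → divisor c < B) (constraintsBelow h α β B)
  constraintsBelow-< zero = []
  constraintsBelow-< (suc B) with h B
  ... | true = ≤-refl ∷ All.map m≤n⇒m≤1+n (constraintsBelow-< B)
  ... | false = All.map m≤n⇒m≤1+n (constraintsBelow-< B)

  constraintsBelow-admissible : (∀ x → T (h x) → Prime x × ¬ x ∣ β) → ∀ B →
    Admissible (constraintsBelow h α β B)
  constraintsBelow-admissible h⇒ zero = []
  constraintsBelow-admissible h⇒ (suc B) with h B in eq
  ... | true = (proj₁ (h⇒ B hB) , proj₂ (h⇒ B hB) , All.map (λ x<B x≡B → <-irrefl x≡B x<B) (constraintsBelow-< B))
               ∷ constraintsBelow-admissible h⇒ B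
    where hB = subst T (sym eq) _
  ... | false = constraintsBelow-admissible h⇒ B

  constraintsBelow-≢ : ∀ {q} → (∀ x → T (h x) → x ≢ q) → ∀ B →
    All (λ c → divisor c ≢ q) (constraintsBelow h α β B)
  constraintsBelow-≢ h⇒≢ zero = []
  constraintsBelow-≢ h⇒≢ (suc B) with h B in eq
  ... | true = h⇒≢ B (subst T (sym eq) _) ∷ constraintsBelow-≢ h⇒≢ B
  ... | false = constraintsBelow-≢ h⇒≢ B

  satisfies-constraintsBelow⇒ : ∀ {w} B → T (satisfies (constraintsBelow h α β B) w) →
    ∀ x → x < B → T (h x) → ¬ x ∣ α + β * w
  satisfies-constraintsBelow⇒ {w} (suc B) sat x x<1+B hx with h B in eq | m≤n⇒m<n∨m≡n x<1+B
  ... | true | inj₂ refl = T-not-does⇒¬ (x ∣? _) (proj₁ (Equivalence.to T-∧ sat))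
  ... | true | inj₁ x<B = satisfies-constraintsBelow⇒ B (proj₂ (Equivalence.to T-∧ sat)) x (s≤s⁻¹ x<B) hx
  ... | false | inj₂ refl = ⊥-elim (subst T eq hx)
  ... | false | inj₁ x<B = satisfies-constraintsBelow⇒ B sat x (s≤s⁻¹ x<B) hx

  ⇒satisfies-constraintsBelow : ∀ {w} B → (∀ x → x < B → T (h x) → ¬ x ∣ α + β * w) →
    T (satisfies (constraintsBelow h α β B) w)
  ⇒satisfies-constraintsBelow zero _ = _
  ⇒satisfies-constraintsBelow (suc B) none with h B in eq
  ... | true = Equivalence.from T-∧
                 ( ¬⇒T-not-does (B ∣? _) (none B ≤-refl (subst T (sym eq) _))
                 , ⇒satisfies-constraintsBelow B (λ x x<B → none x (m≤n⇒m≤1+n x<B)) )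
  ... | false = ⇒satisfies-constraintsBelow B (λ x x<B → none x (m≤n⇒m≤1+n x<B))

  modulus-constraintsBelow : ∀ B → modulus (constraintsBelow h α β B) ≡ prodBelow h B
  modulus-constraintsBelow zero = refl
  modulus-constraintsBelow (suc B) with h B
  ... | true = trans (cong (B *_) (modulus-constraintsBelow B)) (*-comm B _)
  ... | false = trans (modulus-constraintsBelow B) (sym (*-identityʳ _))

  length-constraintsBelow : ∀ B → length (constraintsBelow h α β B) ≡ count h B
  length-constraintsBelow zero = refl
  length-constraintsBelow (suc B) with h B
  ... | true = cong suc (length-constraintsBelow B)
  ... | false = length-constraintsBelow B

totient-constraintsBelow : ∀ h α β α′ β′ B →
  totient (constraintsBelow h α β B) ≡ totient (constraintsBelow h α′ β′ B)
totient-constraintsBelow h α β α′ β′ zero = refl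
totient-constraintsBelow h α β α′ β′ (suc B) with h B
... | true = cong ((B ∸ 1) *_) (totient-constraintsBelow h α β α′ β′ B)
... | false = totient-constraintsBelow h α β α′ β′ B

∤-with-exception : ∀ (h : ℕ → Bool) {q w B} → ¬ q ∣ w → (∀ x → x < B → T (h x ∧ not (x ≡ᵇ q)) → ¬ x ∣ w) →
  ∀ x → x < B → T (h x) → ¬ x ∣ w
∤-with-exception h {q} q∤w others∤w x x<B hx with x ≟ q
... | yes refl = q∤w
... | no x≢q = others∤w x x<B (Equivalence.from (T-∧ {h x} {not (x ≡ᵇ q)}) (hx , ¬⇒T-not-does (x ≟ q) x≢q))

φ≡count : ∀ n → φ n ≡ count (λ u → does (gcd (suc u) n ≟ 1)) n
φ≡count n = length-filter-applyUpTo (λ k → gcd k n ≟ 1) suc n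

ω≡count : ∀ n → ω n ≡ count (λ x → does (prime? x ×-dec x ∣? n)) (suc n)
ω≡count n = length-filter-applyUpTo (λ x → prime? x ×-dec x ∣? n) (λ x → x) (suc n)

count≤ω : ∀ {h} B P .{{_ : NonZero P}} → (∀ x → x < B → T (h x) → Prime x × x ∣ P) → count h B ≤ ω P
count≤ω B P prime-divisor = subst (_ ≤_) (sym (ω≡count P)) (count-transfer B (suc P) λ x x<B hx →
  ⇒T-does (prime? x ×-dec x ∣? P) (prime-divisor x x<B hx) , s≤s (∣⇒≤ (proj₂ (prime-divisor x x<B hx))))

-- Every u < P with gcd (u + 1) P ≡ 1 survives sieving u + 1 by the primes of h.
φ-bound : ∀ h B P → (∀ x → T (h x) → Prime x) → prodBelow h B ∣ P →
  φ P * prodBelow h B ≤ P * totient (constraintsBelow h 0 1 B)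
φ-bound h B P h⇒prime Q∣P = begin
  φ P * Q                             ≡⟨ cong (_* Q) (φ≡count P) ⟩
  count coprime P * Q                 ≤⟨ *-monoˡ-≤ Q (count-mono P coprime⇒sieved) ⟩
  sieveCount cs 1 1 P * Q             ≡⟨ cong (λ z → sieveCount cs 1 1 z * Q) P≡YQ ⟩
  sieveCount cs 1 1 (Y * Q′) * Q      ≡⟨ cong (sieveCount cs 1 1 (Y * Q′) *_) (sym Q′≡Q) ⟩
  sieveCount cs 1 1 (Y * Q′) * Q′     ≡⟨ sieve-exact adm 1 1 (coprimeTo-1 (admissible-primes adm)) Y ⟩
  Y * Q′ * totient cs                 ≡⟨ cong (_* totient cs) (sym P≡YQ) ⟩
  P * totient cs                      ∎
  where
  open ≤-Reasoning
  Q = prodBelow h B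
  cs = constraintsBelow h 0 1 B
  Q′ = modulus cs
  Q′≡Q = modulus-constraintsBelow h 0 1 B
  Y = quotient Q∣P
  P≡YQ : P ≡ Y * Q′
  P≡YQ = trans (m∣n⇒n≡quotient*m Q∣P) (cong (Y *_) (sym Q′≡Q))
  adm : Admissible cs
  adm = constraintsBelow-admissible h 0 1 (λ x hx → h⇒prime x hx , λ x∣1 → prime⇒≢1 (h⇒prime x hx) (∣1⇒≡1 x∣1)) B
  coprime : ℕ → Bool
  coprime u = does (gcd (suc u) P ≟ 1)
  coprime⇒sieved : ∀ u → u < P → T (coprime u) → T (satisfies cs (1 + 1 * u))
  coprime⇒sieved u _ t = ⇒satisfies-constraintsBelow h 0 1 {1 + 1 * u} B λ x x<B hx x∣ →
    prime⇒≢1 (h⇒prime x hx) (gcd≡1⇒coprime (T-does⇒ (gcd (suc u) P ≟ 1) t)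
      (subst (x ∣_) (trans (*-identityˡ _) (cong suc (*-identityˡ u))) x∣ , ∣-trans (∣-prodBelow x<B hx) Q∣P))

-- Opened locally: the prefix +_ would make sections like (x +_) ambiguous.
module _ where
  open import Data.Integer using (+_)

  2∣⇒2∣%ℕ8 : ∀ D → + 2 ℤ.∣ D → 2 ∣ D ℤ.%ℕ 8
  2∣⇒2∣%ℕ8 D 2∣D = ℤ.∣⇒∣ᵤ {i = + (D ℤ.%ℕ 8)} (ℤ.∣m+n∣n⇒∣m (subst (+ 2 ℤ.∣_) (ℤ.a≡a%ℕn+[a/ℕn]*n D 8) 2∣D)
                                (ℤ.∣n⇒∣m*n (D ℤ./ℕ 8) (ℤ.∣ᵤ⇒∣ {i = + 8} (divides 4 refl))))

  kronecker-2-even : ∀ D → + 2 ℤ.∣ D → kronecker D 2 ≡ + 0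
  kronecker-2-even D 2∣D rewrite n∣m⇒m%n≡0 (D ℤ.%ℕ 8) 2 (2∣⇒2∣%ℕ8 D 2∣D) = refl

  2∉ℙ[-4x] : ∀ x → ¬ T (inPD (minus4 x) 2)
  2∉ℙ[-4x] x t =
    subst (λ k → T (does (k ℤ.≟ ℤ.- + 1))) (kronecker-2-even (minus4 x) 2∣-4x) (proj₂ (Equivalence.to T-∧ t))
    where
    2∣-4x : + 2 ℤ.∣ minus4 x
    2∣-4x = ℤ.∣m⇒∣-m (ℤ.∣ᵤ⇒∣ {i = + (4 * x)} (∣m⇒∣m*n x (divides 2 refl)))

  ≅-from-≡ : ∀ k x y K K′ → x + k * K′ ≡ y + k * K → x ≅ y [mod k ]
  ≅-from-≡ k x y K K′ eq = ℤ.∣⇒∣ᵤ (ℤ.divides (+ K ℤ.- + K′) (begin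
    + x ℤ.- + y              ≡⟨ shuffle (+ x) (+ y) (+ k) (+ K) (+ K′) ⟩
    lhs ℤ.- rhs ℤ.+ d        ≡⟨ cong (λ z → z ℤ.- rhs ℤ.+ d) lift ⟩
    rhs ℤ.- rhs ℤ.+ d        ≡⟨ cong (ℤ._+ d) (ℤ.+-inverseʳ rhs) ⟩
    ℤ.0ℤ ℤ.+ d               ≡⟨ ℤ.+-identityˡ d ⟩
    d                        ∎))
    where
    open ≡-Reasoning
    lhs rhs d : ℤ
    lhs = + x ℤ.+ + k ℤ.* + K′
    rhs = + y ℤ.+ + k ℤ.* + K
    d = (+ K ℤ.- + K′) ℤ.* + k
    shuffle : ∀ x y k K K′ → x ℤ.- y ≡ (x ℤ.+ k ℤ.* K′) ℤ.- (y ℤ.+ k ℤ.* K) ℤ.+ (K ℤ.- K′) ℤ.* k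
    shuffle = ℤRing.solve-∀
    lift : lhs ≡ rhs
    lift = begin
      + x ℤ.+ + k ℤ.* + K′   ≡⟨ cong (ℤ._+_ (+ x)) (ℤ.pos-* k K′) ⟨
      + x ℤ.+ + (k * K′)     ≡⟨ ℤ.pos-+ x (k * K′) ⟨
      + (x + k * K′)         ≡⟨ cong +_ eq ⟩
      + (y + k * K)          ≡⟨ ℤ.pos-+ y (k * K) ⟩
      + y ℤ.+ + (k * K)      ≡⟨ cong (ℤ._+_ (+ y)) (ℤ.pos-* k K) ⟩
      + y ℤ.+ + k ℤ.* + K    ∎

ℙ-prime : ∀ {D q} → T (inPD D q) → Prime q
ℙ-prime {q = q} t = T-does⇒ (prime? q) (proj₁ (Equivalence.to T-∧ t))

ℙ[-4x]-≢2 : ∀ x {q} → T (inPD (minus4 x) q) → q ≢ 2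
ℙ[-4x]-≢2 x t refl = 2∉ℙ[-4x] x t

record InPm (m l₁ l₂ q : ℕ) : Set where
  field
    prime-q : Prime q
    in-ℙ : T (inPD (minus4 l₂) q)
    ∤m-2 : ¬ q ∣ m ∸ 2

inPm⇒ : ∀ {m l₁ l₂ q} → T (inPm m l₁ l₂ q) → InPm m l₁ l₂ q
inPm⇒ {m} {l₁} {l₂} {q} t = record
  { prime-q = T-does⇒ (prime? q) isPrime-q
  ; in-ℙ = Equivalence.from T-∧ (isPrime-q , proj₁ rest₂)
  ; ∤m-2 = T-not-does⇒¬ (q ∣? (m ∸ 2)) (proj₂ rest₂) }
  where
  isPrime-q = proj₁ (Equivalence.to (T-∧ {isPrime q}) t)
  rest₁ = Equivalence.to (T-∧ {q ∣ᵇ l₁}) (proj₂ (Equivalence.to (T-∧ {isPrime q}) t))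
  rest₂ = Equivalence.to (T-∧ {kronNeg (minus4 l₂) q}) (proj₂ rest₁)

inPm-prime : ∀ {m l₁ l₂ q} → T (inPm m l₁ l₂ q) → Prime q
inPm-prime {m} {l₁} {l₂} t = InPm.prime-q (inPm⇒ {m} {l₁} {l₂} t)

ordF-∤ : ∀ f p x → ¬ p ∣ x → ordF f p x ≡ 0
ordF-∤ zero p x p∤x = refl
ordF-∤ (suc f) p zero p∤x = refl
ordF-∤ (suc f) p (suc x) p∤x with p ∣? suc x
... | yes p∣x = ⊥-elim (p∤x p∣x)
... | no _ = refl

ordF-once : ∀ f p N → p ∣ suc N → ¬ p ∣ (suc N div p) → ordF (suc f) p (suc N) ≡ 1
ordF-once f p N p∣N p∤N/p with p ∣? suc N
... | yes _ = cong suc (ordF-∤ f p (suc N div p) p∤N/p)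
... | no p∤N = ⊥-elim (p∤N p∣N)

ord-exactly-once : ∀ p K .{{_ : NonZero p}} → ¬ p ∣ K → ord p (p * K) ≡ 1
ord-exactly-once p zero p∤K = ⊥-elim (p∤K (p ∣0))
ord-exactly-once (suc p₁) K@(suc K₁) p∤K =
  ordF-once (K₁ + p₁ * K) (suc p₁) (K₁ + p₁ * K) (m∣m*n K) (subst (λ z → ¬ suc p₁ ∣ z) (sym pK/p≡K) p∤K)
  where
  pK/p≡K : suc p₁ * K / suc p₁ ≡ K
  pK/p≡K = trans (cong (_/ suc p₁) (*-comm (suc p₁) K)) (m*n/n≡m K (suc p₁))

no-common-prime⇒gcd≡1 : ∀ {x y} → (∀ r → Prime r → r ∣ x → r ∣ y → ⊥) → gcd x y ≡ 1
no-common-prime⇒gcd≡1 {x} {y} none = coprime⇒gcd≡1 coprime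
  where
  coprime : Coprime x y
  coprime {zero} (0∣x , 0∣y) =
    ⊥-elim (none 2 prime[2] (subst (2 ∣_) (sym (0∣⇒≡0 0∣x)) (2 ∣0)) (subst (2 ∣_) (sym (0∣⇒≡0 0∣y)) (2 ∣0)))
  coprime {suc zero} _ = refl
  coprime {suc (suc d)} (d∣x , d∣y) with prime-factor (suc (suc d)) (s≤s (s≤s z≤n))
  ... | r , pr , r∣d = ⊥-elim (none r pr (∣-trans r∣d d∣x) (∣-trans r∣d d∣y))

∤⇒gcd-prodBelow≡1 : ∀ (h : ℕ → Bool) {w} B → (∀ x → T (h x) → Prime x) →
  (∀ x → x < B → T (h x) → ¬ x ∣ w) → gcd w (prodBelow h B) ≡ 1
∤⇒gcd-prodBelow≡1 h {w} B h⇒prime h∤w = no-common-prime⇒gcd≡1 λ r pr r∣w r∣prod →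
  let (x , x<B , hx , r≡x) = prime∣prodBelow pr h⇒prime B r∣prod
  in h∤w x x<B hx (subst (_∣ w) r≡x r∣w)

div≡/ : ∀ x p .{{_ : NonZero p}} → x div p ≡ x / p
div≡/ x (suc p) = refl

-- q / (q - 1) ≤ 3 / 2 for q ≥ 3
≤-3* : ∀ q Z T → 3 ≤ q → (q ∸ 1) * Z ≤ 2 * (q * T) → Z ≤ 3 * T
≤-3* 0 _ _ () _
≤-3* 1 _ _ (s≤s ()) _
≤-3* 2 _ _ (s≤s (s≤s ())) _
≤-3* (suc (suc (suc q₃))) Z T _ hyp = *-cancelˡ-≤ (2 * (2 + q₃)) (begin
  2 * (2 + q₃) * Z          ≡⟨ *-assoc 2 (2 + q₃) Z ⟩
  2 * ((2 + q₃) * Z)        ≤⟨ *-monoʳ-≤ 2 hyp ⟩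
  2 * (2 * ((3 + q₃) * T))  ≡⟨ expand₁ q₃ T ⟩
  (12 + 4 * q₃) * T         ≤⟨ *-monoˡ-≤ T (+-monoʳ-≤ 12 (*-monoˡ-≤ q₃ {4} {6} (s≤s (s≤s (s≤s (s≤s z≤n)))))) ⟩
  (12 + 6 * q₃) * T         ≡⟨ expand₂ q₃ T ⟩
  2 * (2 + q₃) * (3 * T)    ∎)
  where
  open ≤-Reasoning
  expand₁ : ∀ q₃ T → 2 * (2 * ((3 + q₃) * T)) ≡ (12 + 4 * q₃) * T
  expand₁ = solve-∀
  expand₂ : ∀ q₃ T → (12 + 6 * q₃) * T ≡ 2 * (2 + q₃) * (3 * T)
  expand₂ = solve-∀

sieve-totient-bound : ∀ {X q Q Φ φ′ P} k .{{_ : NonZero Φ}} → 3 ≤ q →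
  X * ((q ∸ 1) * Φ) ≤ 2 ^ suc k * (q * Q) → φ′ * Q ≤ P * Φ → X * φ′ ≤ 3 * (2 ^ k * P)
sieve-totient-bound {X} {q} {Q} {Φ} {φ′} {P} k 3≤q sieve totient =
  ≤-3* q (X * φ′) (2 ^ k * P) 3≤q (*-cancelʳ-≤ _ _ Φ (begin
    (q ∸ 1) * (X * φ′) * Φ         ≡⟨ regroup₁ (q ∸ 1) X φ′ Φ ⟩
    X * ((q ∸ 1) * Φ) * φ′         ≤⟨ *-monoˡ-≤ φ′ sieve ⟩
    2 ^ suc k * (q * Q) * φ′       ≡⟨ regroup₂ (2 ^ k) q Q φ′ ⟩
    2 * (q * 2 ^ k) * (φ′ * Q)     ≤⟨ *-monoʳ-≤ (2 * (q * 2 ^ k)) totient ⟩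
    2 * (q * 2 ^ k) * (P * Φ)      ≡⟨ regroup₃ q (2 ^ k) P Φ ⟩
    2 * (q * (2 ^ k * P)) * Φ      ∎))
  where
  open ≤-Reasoning
  regroup₁ : ∀ d X φ Φ → d * (X * φ) * Φ ≡ X * (d * Φ) * φ
  regroup₁ = solve-∀
  regroup₂ : ∀ t q Q φ → 2 * t * (q * Q) * φ ≡ 2 * (q * t) * (φ * Q)
  regroup₂ = solve-∀
  regroup₃ : ∀ q t P Φ → 2 * (q * t) * (P * Φ) ≡ 2 * (q * (t * P)) * Φ
  regroup₃ = solve-∀

scale-bound : ∀ {n X φ′ k P} q₀² q W Pab → n ≤ 8 * q₀² * q * X → X * φ′ ≤ 3 * (2 ^ k * P) →
  2 ^ k ≤ W → 1 ≤ Pab → n * φ′ ≤ 24 * Pab * (W * P) * q₀² * q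
scale-bound {n} {X} {φ′} {k} {P} q₀² q W Pab n≤ Xφ′≤ 2^k≤W 1≤Pab = begin
  n * φ′                           ≤⟨ *-monoˡ-≤ φ′ n≤ ⟩
  8 * q₀² * q * X * φ′             ≡⟨ *-assoc (8 * q₀² * q) X φ′ ⟩
  8 * q₀² * q * (X * φ′)           ≤⟨ *-monoʳ-≤ (8 * q₀² * q) Xφ′≤ ⟩
  8 * q₀² * q * (3 * (2 ^ k * P))  ≡⟨ regroup q₀² q (2 ^ k) P ⟩
  24 * 1 * (2 ^ k * P) * q₀² * q   ≤⟨ *-monoˡ-≤ q (*-monoˡ-≤ q₀² (*-mono-≤ (*-monoʳ-≤ 24 1≤Pab) (*-monoˡ-≤ P 2^k≤W))) ⟩
  24 * Pab * (W * P) * q₀² * q     ∎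
  where
  open ≤-Reasoning
  regroup : ∀ a q t P → 8 * a * q * (3 * (t * P)) ≡ 24 * 1 * (t * P) * a * q
  regroup = solve-∀

-- The construction

module Construction (m a b c q₀ q : ℕ) (q₀-spec : IsQ0 m a b c q₀) (q-spec : InQSeq m a b q₀ q) where

  M : ℕ
  M = m ∸ 2

  ab : ℕ
  ab = a * b

  q₀-conditions : T (inPD (minus4 ab) q₀) × T (not (q₀ ∣ᵇ M) ∧ not (inPm m c ab q₀))
  q₀-conditions = Equivalence.to (T-∧ {inPD (minus4 ab) q₀}) (proj₁ q₀-spec)
  q₀-divisibility : T (not (q₀ ∣ᵇ M)) × T (not (inPm m c ab q₀))
  q₀-divisibility = Equivalence.to (T-∧ {not (q₀ ∣ᵇ M)}) (proj₂ q₀-conditions)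

  prime-q₀ : Prime q₀
  prime-q₀ = ℙ-prime (proj₁ q₀-conditions)

  q₀∤M : ¬ q₀ ∣ M
  q₀∤M = T-not-does⇒¬ (q₀ ∣? M) (proj₁ q₀-divisibility)

  q₀∉Pc : ¬ T (inPm m c ab q₀)
  q₀∉Pc = T-not⇒¬T (proj₂ q₀-divisibility)

  q₀≢2 : q₀ ≢ 2
  q₀≢2 = ℙ[-4x]-≢2 ab (proj₁ q₀-conditions)

  prime-q : Prime q
  prime-q = ℙ-prime (proj₁ q-spec)

  q≢2 : q ≢ 2
  q≢2 = ℙ[-4x]-≢2 ab (proj₁ q-spec)

  q∤q₀ : ¬ q ∣ q₀
  q∤q₀ q∣q₀ = proj₂ q-spec (∣m⇒∣m*n M q∣q₀)

  q∤M : ¬ q ∣ M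
  q∤M q∣M = proj₂ q-spec (∣n⇒∣m*n q₀ q∣M)

  instance
    q₀-nonZero : NonZero q₀
    q₀-nonZero = prime⇒nonZero prime-q₀
    q₀²-nonZero : NonZero (q₀ ^ 2)
    q₀²-nonZero = m^n≢0 q₀ 2
    q-nonZero : NonZero q
    q-nonZero = prime⇒nonZero prime-q

  L : ℕ
  L = 8 * q₀ ^ 2

  β₀ : ℕ
  β₀ = 8 * M * L

  odd-prime∤β₀ : ∀ {r} → Prime r → r ≢ 2 → ¬ r ∣ M → r ≢ q₀ → ¬ r ∣ β₀
  odd-prime∤β₀ pr r≢2 r∤M r≢q₀ =
    prime∤-* pr (prime∤-* pr ∤8 r∤M) (prime∤-* pr ∤8 (prime∤-^ pr (λ r∣q₀ → r≢q₀ (prime∣prime⇒≡ prime-q₀ pr r∣q₀)) 2))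
    where ∤8 = odd-prime∤2^ pr r≢2 3

  coprime-64M-q₀² : Coprime (64 * M) (q₀ ^ 2)
  coprime-64M-q₀² = gcd≡1⇒coprime (no-common-prime⇒gcd≡1 q₀-only)
    where
    q₀-only : ∀ r → Prime r → r ∣ 64 * M → r ∣ q₀ ^ 2 → ⊥
    q₀-only r pr r∣64M r∣q₀² with r ∣? q₀
    ... | no r∤q₀ = prime∤-^ pr r∤q₀ 2 r∣q₀²
    ... | yes r∣q₀ = prime∤-* prime-q₀ (odd-prime∤2^ prime-q₀ q₀≢2 6) q₀∤M
                       (subst (_∣ 64 * M) (prime∣prime⇒≡ prime-q₀ pr r∣q₀) r∣64M)

  B₀ C₀ Y₈ e R : ℕ
  B₀ = (m ∸ 4) ^ 2 * (a + b)
  C₀ = 8 * M * c + q₀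
  Y₈ = (2 div ord 2 m) * (a + b + c)
  e = (Y₈ + 7) % 8 + 1
  R = pred (q₀ ^ 2)

  -- 64 M v ≡ C₀ - 8 M e - B₀ (mod q₀²), with the -1 written as R = q₀² - 1
  v₀-root : ∃ λ v → v < q₀ ^ 2 × q₀ ^ 2 ∣ (8 * M * e + B₀ + C₀ * R) + 64 * M * v
  v₀-root = solve-linear (8 * M * e + B₀ + C₀ * R) (64 * M) coprime-64M-q₀²

  v₀ s : ℕ
  v₀ = proj₁ v₀-root
  s = e + 8 * v₀

  q∤β₀ : ¬ q ∣ β₀
  q∤β₀ = odd-prime∤β₀ prime-q q≢2 q∤M (λ q≡q₀ → q∤q₀ (subst (q ∣_) q≡q₀ ∣-refl))

  t₀-root : ∃ λ t → t < q × q ∣ (8 * M * s + B₀) + β₀ * t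
  t₀-root = solve-linear (8 * M * s + B₀) β₀ (prime∤⇒coprime prime-q q∤β₀)

  t₀ K₀ : ℕ
  t₀ = proj₁ t₀-root
  K₀ = quotient (proj₂ (proj₂ t₀-root))

  inPc∖q : ℕ → Bool
  inPc∖q x = inPm m c ab x ∧ not (x ≡ᵇ q)

  inPc∖q⇒ : ∀ {x} → T (inPc∖q x) → InPm m c ab x × x ≢ q
  inPc∖q⇒ {x} t = inPm⇒ (proj₁ t′) , λ x≡q → T-not⇒¬T (proj₂ t′) (≡⇒≡ᵇ x q x≡q)
    where t′ = Equivalence.to (T-∧ {inPm m c ab x}) t

  csPc cs : List Constraint
  csPc = constraintsBelow inPc∖q K₀ β₀ (suc c)
  cs = avoid q K₀ β₀ ∷ csPc

  csPc-admissible : Admissible csPc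
  csPc-admissible = constraintsBelow-admissible inPc∖q K₀ β₀ admissible (suc c)
    where
    admissible : ∀ x → T (inPc∖q x) → Prime x × ¬ x ∣ β₀
    admissible x t = InPm.prime-q info , odd-prime∤β₀ (InPm.prime-q info) (ℙ[-4x]-≢2 ab (InPm.in-ℙ info))
                       (InPm.∤m-2 info) (λ x≡q₀ → q₀∉Pc (subst (T ∘ inPm m c ab) x≡q₀ (proj₁ (Equivalence.to (T-∧ {inPm m c ab x}) t))))
      where info = proj₁ (inPc∖q⇒ t)

  cs-admissible : Admissible cs
  cs-admissible = (prime-q , q∤β₀ , constraintsBelow-≢ inPc∖q K₀ β₀ (λ x t → proj₂ (inPc∖q⇒ t)) (suc c))
                  ∷ csPc-admissible

  instance
    totient-nonZero : NonZero (totient cs)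
    totient-nonZero = >-nonZero (totient-pos cs-admissible)

  X : ℕ
  X = 2 ^ length cs * modulus cs / totient cs

  X-large : 2 ^ length cs * modulus cs < X * totient cs + modulus cs
  X-large = begin-strict
    2 ^ length cs * modulus cs                                       ≡⟨ m≡m%n+[m/n]*n _ (totient cs) ⟩
    2 ^ length cs * modulus cs % totient cs + X * totient cs         <⟨ +-monoˡ-< _ (<-≤-trans (m%n<n _ (totient cs)) (totient≤modulus cs)) ⟩
    modulus cs + X * totient cs                                      ≡⟨ +-comm (modulus cs) _ ⟩
    X * totient cs + modulus cs                                      ∎
    where open ≤-Reasoning

  witness : ∃ λ u → u < X × T (satisfies cs u)
  witness = sieve-witness cs-admissible X X-large

  u : ℕ
  u = proj₁ witness

  u-sieved : T (not (q ∣ᵇ (K₀ + β₀ * u))) × T (satisfies csPc u)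
  u-sieved = Equivalence.to (T-∧ {not (q ∣ᵇ (K₀ + β₀ * u))}) (proj₂ (proj₂ witness))

  q∤K : ¬ q ∣ K₀ + β₀ * u
  q∤K = T-not-does⇒¬ (q ∣? K₀ + β₀ * u) (proj₁ u-sieved)

  inPc∖q-∤K : ∀ x → x < suc c → T (inPc∖q x) → ¬ x ∣ K₀ + β₀ * u
  inPc∖q-∤K = satisfies-constraintsBelow⇒ inPc∖q K₀ β₀ (suc c) (proj₂ u-sieved)

  n N : ℕ
  n = s + L * (t₀ + q * u)
  N = 8 * M * n + B₀

  N≡q*K : N ≡ q * (K₀ + β₀ * u)
  N≡q*K = begin
    8 * M * (s + L * (t₀ + q * u)) + B₀          ≡⟨ expand M s L t₀ q u B₀ ⟩
    (8 * M * s + B₀ + β₀ * t₀) + β₀ * q * u      ≡⟨ cong (_+ β₀ * q * u) (m∣n⇒n≡m*quotient (proj₂ (proj₂ t₀-root))) ⟩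
    q * K₀ + β₀ * q * u                           ≡⟨ collect q K₀ β₀ u ⟩
    q * (K₀ + β₀ * u)                             ∎
    where
    open ≡-Reasoning
    expand : ∀ M s L t q u B → 8 * M * (s + L * (t + q * u)) + B ≡ (8 * M * s + B + 8 * M * L * t) + 8 * M * L * q * u
    expand = solve-∀
    collect : ∀ q K β u → q * K + β * q * u ≡ q * (K + β * u)
    collect = solve-∀

  N-ord : ord q N ≡ 1
  N-ord = subst (λ z → ord q z ≡ 1) (sym N≡q*K) (ord-exactly-once q (K₀ + β₀ * u) q∤K)

  N-mod-8M : N ≅ B₀ [mod 8 * M ]
  N-mod-8M = ≅-from-≡ (8 * M) N B₀ n 0 (swap (8 * M) n B₀)
    where
    swap : ∀ k n B → k * n + B + k * 0 ≡ B + k * n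
    swap = solve-∀

  N-mod-q₀² : N ≅ C₀ [mod q₀ ^ 2 ]
  N-mod-q₀² = ≅-from-≡ (q₀ ^ 2) N C₀ (W + 64 * M * (t₀ + q * u)) C₀ (begin
    N + q₀ ^ 2 * C₀                                          ≡⟨ cong (λ Q → 8 * M * (s + 8 * Q * (t₀ + q * u)) + B₀ + Q * C₀) (sym (suc-pred (q₀ ^ 2))) ⟩
    8 * M * (s + 8 * suc R * (t₀ + q * u)) + B₀ + suc R * C₀ ≡⟨ expand M e v₀ R t₀ q u B₀ C₀ ⟩
    C₀ + ((8 * M * e + B₀ + C₀ * R + 64 * M * v₀) + suc R * (64 * M * (t₀ + q * u)))
                                                             ≡⟨ cong (λ z → C₀ + (z + suc R * (64 * M * (t₀ + q * u)))) (m∣n⇒n≡m*quotient (proj₂ (proj₂ v₀-root))) ⟩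
    C₀ + (q₀ ^ 2 * W + suc R * (64 * M * (t₀ + q * u)))      ≡⟨ cong (λ z → C₀ + (q₀ ^ 2 * W + z * (64 * M * (t₀ + q * u)))) (suc-pred (q₀ ^ 2)) ⟩
    C₀ + (q₀ ^ 2 * W + q₀ ^ 2 * (64 * M * (t₀ + q * u)))     ≡⟨ cong (C₀ +_) (sym (*-distribˡ-+ (q₀ ^ 2) W _)) ⟩
    C₀ + q₀ ^ 2 * (W + 64 * M * (t₀ + q * u))                ∎)
    where
    open ≡-Reasoning
    W = quotient (proj₂ (proj₂ v₀-root))
    expand : ∀ M e v R t q u B C → 8 * M * ((e + 8 * v) + 8 * suc R * (t + q * u)) + B + suc R * C
           ≡ C + ((8 * M * e + B + C * R + 64 * M * v) + suc R * (64 * M * (t + q * u)))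
    expand = solve-∀

  N/q≡K : N div q ≡ K₀ + β₀ * u
  N/q≡K = begin
    N div q                  ≡⟨ div≡/ N q ⟩
    N / q                    ≡⟨ cong (_/ q) (trans N≡q*K (*-comm q _)) ⟩
    (K₀ + β₀ * u) * q / q    ≡⟨ m*n/n≡m (K₀ + β₀ * u) q ⟩
    K₀ + β₀ * u              ∎
    where open ≡-Reasoning

  Pc-∤K : ∀ x → x < suc c → T (inPm m c ab x) → ¬ x ∣ K₀ + β₀ * u
  Pc-∤K = ∤-with-exception (inPm m c ab) q∤K inPc∖q-∤K

  N/q-coprime-Pc : gcd (N div q) (Pc m a b c) ≡ 1
  N/q-coprime-Pc = subst₂ (λ x y → gcd x y ≡ 1) (sym N/q≡K) (sym (prodUpTo≡prodBelow c (inPm m c ab)))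
    (∤⇒gcd-prodBelow≡1 (inPm m c ab) (suc c) (λ x t → InPm.prime-q (inPm⇒ {m} {c} {ab} t)) Pc-∤K)

  n-pos : 0 < n
  n-pos = ≤-trans (m≤n+m 1 ((Y₈ + 7) % 8)) (≤-trans (m≤m+n e (8 * v₀)) (m≤m+n s _))

  n-mod-8 : n ≅ Y₈ [mod 8 ]
  n-mod-8 = ≅-from-≡ 8 n Y₈ (1 + v₀ + q₀ ^ 2 * (t₀ + q * u)) ((Y₈ + 7) / 8) (begin
    n + 8 * ((Y₈ + 7) / 8)                                               ≡⟨ regroup ((Y₈ + 7) % 8) v₀ (q₀ ^ 2) (t₀ + q * u) ((Y₈ + 7) / 8) ⟩
    ((Y₈ + 7) % 8 + (Y₈ + 7) / 8 * 8) + 1 + 8 * (v₀ + q₀ ^ 2 * (t₀ + q * u)) ≡⟨ cong (λ z → z + 1 + 8 * (v₀ + q₀ ^ 2 * (t₀ + q * u))) (sym (m≡m%n+[m/n]*n (Y₈ + 7) 8)) ⟩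
    Y₈ + 7 + 1 + 8 * (v₀ + q₀ ^ 2 * (t₀ + q * u))                         ≡⟨ collect Y₈ v₀ (q₀ ^ 2) (t₀ + q * u) ⟩
    Y₈ + 8 * (1 + v₀ + q₀ ^ 2 * (t₀ + q * u))                             ∎)
    where
    open ≡-Reasoning
    regroup : ∀ r v Q t k → (r + 1 + 8 * v) + 8 * Q * t + 8 * k ≡ (r + k * 8) + 1 + 8 * (v + Q * t)
    regroup = solve-∀
    collect : ∀ Y v Q t → Y + 7 + 1 + 8 * (v + Q * t) ≡ Y + 8 * (1 + v + Q * t)
    collect = solve-∀

  inPabc inPab : ℕ → Bool
  inPabc x = inPm m a (b * c) x ∨ inPm m b (a * c) x ∨ inPm m c (a * b) x
  inPab x = inPm m a (b * c) x ∨ inPm m b (a * c) x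

  inPab⇒prime : ∀ x → T (inPab x) → Prime x
  inPab⇒prime x t with Equivalence.to (T-∨ {inPm m a (b * c) x}) t
  ... | inj₁ t₁ = inPm-prime {m} {a} {b * c} t₁
  ... | inj₂ t₂ = inPm-prime {m} {b} {a * c} t₂

  inPabc⇒prime : ∀ x → T (inPabc x) → Prime x
  inPabc⇒prime x t with Equivalence.to (T-∨ {inPm m a (b * c) x}) t
  ... | inj₁ t₁ = inPm-prime {m} {a} {b * c} t₁
  ... | inj₂ t₂ with Equivalence.to (T-∨ {inPm m b (a * c) x}) t₂
  ...   | inj₁ t₃ = inPm-prime {m} {b} {a * c} t₃
  ...   | inj₂ t₄ = inPm-prime {m} {c} {ab} t₄

  P : ℕ
  P = Pabc m a b c

  P≡prodBelow : P ≡ prodBelow inPabc (suc (a + b + c))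
  P≡prodBelow = prodUpTo≡prodBelow (a + b + c) inPabc

  instance
    P-nonZero : NonZero P
    P-nonZero = >-nonZero (subst (0 <_) (sym P≡prodBelow)
                  (prodBelow-pos (λ x t → >-nonZero⁻¹ x {{prime⇒nonZero (inPabc⇒prime x t)}}) (suc (a + b + c))))

  inPc∖q⇒inPabc : ∀ x → T (inPc∖q x) → T (inPabc x)
  inPc∖q⇒inPabc x t = Equivalence.from (T-∨ {inPm m a (b * c) x})
    (inj₂ (Equivalence.from (T-∨ {inPm m b (a * c) x}) (inj₂ (proj₁ (Equivalence.to (T-∧ {inPm m c ab x}) t)))))

  Pc∖q∣P : prodBelow inPc∖q (suc c) ∣ P
  Pc∖q∣P = subst (prodBelow inPc∖q (suc c) ∣_) (sym P≡prodBelow)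
    (∣-trans (prodBelow-∣ inPc∖q⇒inPabc (suc c)) (prodBelow-monoʳ-∣ inPabc (s≤s (m≤n+m c (a + b)))))

  length-csPc≤ωP : length csPc ≤ ω P
  length-csPc≤ωP = subst (_≤ ω P) (sym (length-constraintsBelow inPc∖q K₀ β₀ (suc c)))
    (count≤ω (suc c) P λ x x<c t → InPm.prime-q (proj₁ (inPc∖q⇒ t)) , ∣-trans (∣-prodBelow x<c t) Pc∖q∣P)

  φ-bound-csPc : φ P * modulus csPc ≤ P * totient csPc
  φ-bound-csPc = subst₂ (λ Q Φ → φ P * Q ≤ P * Φ)
    (sym (modulus-constraintsBelow inPc∖q K₀ β₀ (suc c)))
    (totient-constraintsBelow inPc∖q 0 1 K₀ β₀ (suc c))
    (φ-bound inPc∖q (suc c) P (λ x t → InPm.prime-q (proj₁ (inPc∖q⇒ t))) Pc∖q∣P)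

  s≤L : s ≤ L
  s≤L = begin
    (Y₈ + 7) % 8 + 1 + 8 * v₀   ≤⟨ +-monoˡ-≤ (8 * v₀) (subst (_≤ 8) (+-comm 1 _) (m%n<n (Y₈ + 7) 8)) ⟩
    8 + 8 * v₀                  ≡⟨ *-suc 8 v₀ ⟨
    8 * suc v₀                  ≤⟨ *-monoʳ-≤ 8 (proj₁ (proj₂ v₀-root)) ⟩
    L                           ∎
    where open ≤-Reasoning

  n≤LqX : n ≤ 8 * q₀ ^ 2 * q * X
  n≤LqX = begin
    s + L * (t₀ + q * u)          ≤⟨ +-monoˡ-≤ _ s≤L ⟩
    L + L * (t₀ + q * u)          ≡⟨ expand L t₀ q u ⟩
    L * suc t₀ + L * (q * u)      ≤⟨ +-monoˡ-≤ _ (*-monoʳ-≤ L (proj₁ (proj₂ t₀-root))) ⟩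
    L * q + L * (q * u)           ≡⟨ collect L q u ⟩
    L * q * suc u                 ≤⟨ *-monoʳ-≤ (L * q) (proj₁ (proj₂ witness)) ⟩
    L * q * X                     ∎
    where
    open ≤-Reasoning
    expand : ∀ L t q u → L + L * (t + q * u) ≡ L * suc t + L * (q * u)
    expand = solve-∀
    collect : ∀ L q u → L * q + L * (q * u) ≡ L * q * suc u
    collect = solve-∀

  n-bound : n * φ P ≤ 24 * Pab m a b c * (2 ^ ω P * P) * q₀ ^ 2 * q
  n-bound = scale-bound {n} {X} {φ P} {length csPc} {P} (q₀ ^ 2) q (2 ^ ω P) (Pab m a b c) n≤LqX
    (sieve-totient-bound {X} {q} {modulus csPc} {totient csPc} {φ P} {P} (length csPc) {{>-nonZero (totient-pos csPc-admissible)}} 3≤q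
       (m/n*n≤m (2 ^ length cs * modulus cs) (totient cs)) φ-bound-csPc)
    (^-monoʳ-≤ 2 length-csPc≤ωP)
    (subst (1 ≤_) (sym (prodUpTo≡prodBelow (a + b) inPab))
       (prodBelow-pos (λ x t → >-nonZero⁻¹ x {{prime⇒nonZero (inPab⇒prime x t)}}) (suc (a + b))))
    where
    3≤q : 3 ≤ q
    3≤q = ≤∧≢⇒< (nonTrivial⇒n>1 q {{prime⇒nonTrivial prime-q}}) (q≢2 ∘ sym)

lemma4p5 : (m a b c : ℕ) → 3 < m → 0 < a → 0 < b → 0 < c →
    (q₀ : ℕ) → IsQ0 m a b c q₀ →
    (q : ℕ) → InQSeq m a b q₀ q →
    ∃[ N ] ∃[ n ]
      ( ord q N ≡ 1
      × N ≅ (m ∸ 4) ^ 2 * (a + b) [mod 8 * (m ∸ 2) ]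
      × N ≅ 8 * (m ∸ 2) * c + q₀ [mod q₀ ^ 2 ]
      × gcd (N div q) (Pc m a b c) ≡ 1
      × N ≡ 8 * (m ∸ 2) * n + (m ∸ 4) ^ 2 * (a + b)
      × 0 < n
      × n * φ (Pabc m a b c) ≤ 24 * Pab m a b c * (2 ^ ω (Pabc m a b c) * Pabc m a b c) * q₀ ^ 2 * q
      × (2 ≤ ord 2 m → n ≅ (2 div ord 2 m) * (a + b + c) [mod 8 ]) )
lemma4p5 m a b c _ _ _ _ q₀ q₀-spec q q-spec =
  N , n , N-ord , N-mod-8M , N-mod-q₀² , N/q-coprime-Pc , refl , n-pos , n-bound , λ _ → n-mod-8
  where open Construction m a b c q₀ q q₀-spec q-spec
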